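{- Let $B$ be a unital algebra over a field of characteristic zero and $f,g\in\mathrm{Mult}[[B]]$. Then $$f\boxplus g=g\circ(f\boxplus_1 g),\qquad g\,\underline{\boxplus}\,f=f\circ\big((f\boxplus_2 g)\cdot I\big).$$
   Context: $\mathrm{Mult}[[B]]$: sequences $f=(f_n)_{n\ge0}$, $f_n:B^n\to B$ multilinear ($f_0\in B$). $(f\cdot g)_n(x_1,\dots,x_n)=\sum_kf_k(x_1,\dots,x_k)g_{n-k}(x_{k+1},\dots,x_n)$; for $g_0=0$, $(f\circ g)_n(x_1,\dots,x_n)=\sum_{l\ge0}\sum_{k_1+\dots+k_l=n,k_i\ge1}f_l(g_{k_1}(x_1,\dots,x_{k_1}),\dots,g_{k_l}(x_{n-k_l+1},\dots,x_n))$; $I_1=\mathrm{Id}_B$, $I_n=0$ otherwise. Trees: $Y_0=\{|\}$, $Y_n=\{\sigma\vee\tau:\sigma\in Y_k,\tau\in Y_l,k+l=n-1\}$ ($\sigma\vee\tau$: root with left subtree $\sigma$, right subtree $\tau$). Each $\tau\in Y_n$, $n\ge1$, is uniquely $\tau_1\vee(\tau_2\vee(\cdots\vee(\tau_k\vee|)))$; $j_i=|\tau_1|+\dots+|\tau_i|+i$. $(f\cup g)_|=1$, $(f\cup g)_\tau(x_1,\dots,x_n)=g_k((g\cup f)_{\tau_1}(x_1,\dots,x_{j_1-1})x_{j_1},\dots,(g\cup f)_{\tau_k}(x_{j_{k-1}+1},\dots,x_{j_k-1})x_{j_k})$. $R(|)=|$, $R(\sigma\vee\tau)=(|\vee R(\sigma))\vee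 R(\tau)$. Four boxed convolutions, for $n\ge1$: $(f\boxplus g)_n(x_1,\dots,x_n)=\sum_{\tau\in Y_n}(f\cup g)_{R(\tau)}(x_1,1,x_2,1,\dots,1,x_n,1)$, $(f\boxplus g)_0=g_0$; $(f\,\underline\boxplus\, g)_n(x_1,\dots,x_n)=\sum_{\tau\in Y_n}(f\cup g)_{R(\tau)}(1,x_1,1,x_2,\dots,1,x_n)$, $(f\,\underline\boxplus\,g)_0=g_0$; $(f\boxplus_1 g)_n(x_1,\dots,x_n)=\sum_{\tau\in Y_{n-1}}(g\cup f)_{|\vee R(\tau)}(x_1,1,x_2,1,\dots,1,x_n)$, $(f\boxplus_1g)_0=0$; $(f\boxplus_2 g)_n(x_1,\dots,x_n)=\sum_{\tau\in Y_n}(f\cup g)_{|\vee R(\tau)}(1,x_1,1,x_2,1,\dots,1,x_n,1)$, $(f\boxplus_2g)_0=g_1(1)$. -}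

module Defs where

open import Level using (Level; _⊔_) renaming (suc to lsuc)
open import Data.Nat.Base using (ℕ; zero; suc) renaming (_+_ to _+ℕ_)
open import Data.Product.Base using (_×_; _,_; ∃)
open import Data.List.Base as List using (List; []; _∷_; _++_; map; foldr; take; drop; length; concatMap; concat)
open import Data.List.Relation.Binary.Pointwise using (Pointwise)
open import Data.Vec.Base as Vec using (Vec)
open import Relation.Nullary using (¬_)
open import Algebra.Bundles using (CommutativeRing; Ring)
open import Algebra.Module.Structures using (IsLeftModule)
import Algebra.Definitions.RawMonoid as RawMonoidDefs

record Field c ℓ : Set (lsuc (c ⊔ ℓ)) where
  field
    commutativeRing : CommutativeRing c ℓ
  open CommutativeRing commutativeRing public
  field
    1≉0     : ¬ (1# ≈ 0#)
    inverse : ∀ x → ¬ (x ≈ 0#) → ∃ λ y → (x * y) ≈ 1#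

CharZero : ∀ {c ℓ} → Field c ℓ → Set ℓ
CharZero F = ∀ (n : ℕ) → ¬ ((suc n ×ℕ 1#) ≈ 0#)
  where
  open Field F
  open RawMonoidDefs +-rawMonoid using () renaming (_×_ to _×ℕ_)

record UnitalAlgebra {c ℓ} (F : Field c ℓ) b ℓb : Set (c ⊔ ℓ ⊔ lsuc (b ⊔ ℓb)) where
  module K = Field F
  field
    ring : Ring b ℓb
  open Ring ring public
  infixr 7 _·_
  field
    _·_          : K.Carrier → Carrier → Carrier
    isLeftModule : IsLeftModule K.ring _≈_ _+_ 0# -_ _·_
    ·-*-assocˡ   : ∀ k x y → ((k · x) * y) ≈ (k · (x * y))
    ·-*-assocʳ   : ∀ k x y → (x * (k · y)) ≈ (k · (x * y))

infixr 5 _∨_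
data Tree : Set where
  leaf : Tree
  _∨_  : Tree → Tree → Tree

size : Tree → ℕ
size leaf    = 0
size (σ ∨ τ) = suc (size σ +ℕ size τ)

R : Tree → Tree
R leaf    = leaf
R (σ ∨ τ) = (leaf ∨ R σ) ∨ R τ

-- table [Y₀, …, Yₙ]; Y_{n+1} = { σ ∨ τ : σ ∈ Y_k, τ ∈ Y_{n-k} }
Ytable : (n : ℕ) → Vec (List Tree) (suc n)
Ytable zero    = (leaf ∷ []) Vec.∷ Vec.[]
Ytable (suc n) = t Vec.∷ʳ concat (Vec.toList (Vec.zipWith joins t (Vec.reverse t)))
  where
  t = Ytable n
  joins : List Tree → List Tree → List Tree
  joins A C = concatMap (λ σ → map (σ ∨_) C) A

Y : ℕ → List Tree
Y n = Vec.last (Ytable n)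

-- Multilinear series over a unital algebra.
-- A family (f_n)_{n≥0}, f_n : Bⁿ → B, is represented as one function
-- List B → B, whose restriction to lists of length n is f_n.

module Series {c ℓ b ℓb} {F : Field c ℓ} (A : UnitalAlgebra F b ℓb) where
  open UnitalAlgebra A

  Seq : Set b
  Seq = List Carrier → Carrier

  record Mult : Set (c ⊔ b ⊔ ℓb) where
    field
      fun      : Seq
      fun-cong : ∀ {xs ys} → Pointwise _≈_ xs ys → fun xs ≈ fun ys
      additive : ∀ (us vs : List Carrier) (x y : Carrier) →
                 fun (us ++ (x + y) ∷ vs) ≈ (fun (us ++ x ∷ vs) + fun (us ++ y ∷ vs))
      homogeneous : ∀ (us vs : List Carrier) (k : K.Carrier) (x : Carrier) →
                 fun (us ++ (k · x) ∷ vs) ≈ (k · fun (us ++ x ∷ vs))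
  open Mult public using () renaming (fun to ⟦_⟧)

  infix 4 _≋_
  _≋_ : Seq → Seq → Set (b ⊔ ℓb)
  f ≋ g = ∀ (xs : List Carrier) → f xs ≈ g xs

  sumB : List Carrier → Carrier
  sumB = foldr _+_ 0#

  I : Seq
  I (x ∷ []) = x
  I _        = 0#

  splits : List Carrier → List (List Carrier × List Carrier)
  splits []       = ([] , []) ∷ []
  splits (x ∷ xs) = ([] , x ∷ xs) ∷ map (λ { (p , q) → (x ∷ p , q) }) (splits xs)

  infixl 7 _⊙_
  _⊙_ : Seq → Seq → Seq
  (f ⊙ g) xs = sumB (map (λ { (p , q) → f p * g q }) (splits xs))

  -- all ways to cut a list into consecutive nonempty blocks, applying g to
  -- every block: the lists (g_{k₁}(…), …, g_{k_l}(…)) for k₁+…+k_l = n, kᵢ ≥ 1.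
  -- `go g acc xs`: acc is the current (nonempty) open block.
  go : Seq → List Carrier → List Carrier → List (List Carrier)
  go g acc []       = (g acc ∷ []) ∷ []
  go g acc (x ∷ xs) = go g (acc ++ x ∷ []) xs ++ map (g acc ∷_) (go g (x ∷ []) xs)

  blocks : Seq → List Carrier → List (List Carrier)
  blocks g []       = [] ∷ []
  blocks g (x ∷ xs) = go g (x ∷ []) xs

  -- composition (only the g_k with k ≥ 1 enter, as g₀ = 0 is assumed)
  infixr 9 _∘ˢ_
  _∘ˢ_ : Seq → Seq → Seq
  (f ∘ˢ g) xs = sumB (map f (blocks g xs))

  -- the element x_{j} following a block (never empty in the uses below)
  hd : List Carrier → Carrier
  hd []      = 0#
  hd (x ∷ _) = x

  -- (f ∪ g)_τ ; for τ = τ₁ ∨ (τ₂ ∨ (… ∨ (τ_k ∨ |))) it is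
  -- g_k((g∪f)_{τ₁}(x₁..x_{j₁-1}) x_{j₁}, …, (g∪f)_{τ_k}(…) x_{j_k})
  mutual
    cup : Seq → Seq → Tree → List Carrier → Carrier
    cup f g leaf    xs = 1#
    cup f g (σ ∨ τ) xs = g (spine f g (σ ∨ τ) xs)

    spine : Seq → Seq → Tree → List Carrier → List Carrier
    spine f g leaf    xs = []
    spine f g (σ ∨ τ) xs =
      (cup g f σ (take (size σ) xs) * hd (drop (size σ) xs))
      ∷ spine f g τ (drop (suc (size σ)) xs)

  x1 : List Carrier → List Carrier
  x1 = concatMap (λ x → x ∷ 1# ∷ [])

  1x : List Carrier → List Carrier
  1x = concatMap (λ x → 1# ∷ x ∷ [])

  _⊞_ : Seq → Seq → Seq
  (f ⊞ g) []         = g []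
  (f ⊞ g) xs@(_ ∷ _) = sumB (map (λ τ → cup f g (R τ) (x1 xs)) (Y (length xs)))

  _⊞̲_ : Seq → Seq → Seq
  (f ⊞̲ g) []         = g []
  (f ⊞̲ g) xs@(_ ∷ _) = sumB (map (λ τ → cup f g (R τ) (1x xs)) (Y (length xs)))

  _⊞₁_ : Seq → Seq → Seq
  (f ⊞₁ g) []       = 0#
  (f ⊞₁ g) (x ∷ xs) = sumB (map (λ τ → cup g f (leaf ∨ R τ) (x ∷ 1x xs)) (Y (length xs)))

  _⊞₂_ : Seq → Seq → Seq
  (f ⊞₂ g) []         = g (1# ∷ [])
  (f ⊞₂ g) xs@(_ ∷ _) = sumB (map (λ τ → cup f g (leaf ∨ R τ) (1# ∷ x1 xs)) (Y (length xs)))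

module Submission where

-- Write τ ∈ Y_n as τ₁ ∨ (τ₂ ∨ (⋯ ∨ (τ_k ∨ |))). Since R (σ ∨ ρ) = (| ∨ R σ) ∨ R ρ, the summand
-- (f ∪ g)_{R τ}(x₁,1,…,x_n,1) of f ⊞ g is g_k applied to the values of (g ∪ f)_{| ∨ R τᵢ} at
-- (x_j,1,x_{j+1},…,1,x_{j'}) for the consecutive blocks x_j,…,x_{j'} of lengths |τᵢ| + 1, each
-- multiplied by the 1 that follows its block. Fixing the block lengths and summing over the τᵢ,
-- multilinearity of g_k turns slot i into the block's value of f ⊞₁ g; summing over all compositions
-- of n then gives g ∘ (f ⊞₁ g). The second identity is the same expansion for the pattern
-- (1,x₁,…,1,x_n): there each block's value is multiplied by the block's last x_{j'} instead of by 1,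
-- which is the right factor recorded by ⊙ I.

open import Defs
open import Data.Product.Base using (_×_; _,_)
open import Level using (Level)
open import Algebra.Bundles using (Semiring)
open import Algebra.Properties.CommutativeSemigroup using (interchange)
open import Algebra.Module.Structures using (IsLeftModule)
open import Data.Nat.Base using (ℕ; zero; suc; _∸_; _<_; _≤_; s≤s) renaming (_+_ to _+ℕ_)
import Data.Nat.Properties as ℕ
open import Data.Nat.Induction using (<-rec)
open import Data.List.Base as List
  using (List; []; _∷_; _++_; _∷ʳ_; map; foldr; concat; concatMap; take; drop; length;
         applyUpTo; applyDownFrom; upTo)
open import Data.List.Properties
  using (applyUpTo-∷ʳ; reverse-applyUpTo; map-applyUpTo; map-cong; map-upTo; ++-assoc; ++-identityʳ;
         length-take; length-drop; take-take; drop-[])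
open import Data.List.Relation.Unary.All as All using (All; []; _∷_)
open import Data.List.Relation.Unary.All.Properties using (concat⁺; map⁺; applyUpTo⁺₁; all-upTo)
open import Data.List.Relation.Binary.Pointwise as Pointwise using (Pointwise; []; _∷_)
open import Data.Vec.Base as Vec using (Vec)
open import Data.Vec.Properties using (last-∷ʳ; toList-∷ʳ; toList-reverse)
open import Function.Base using (_∘_)
open import Relation.Binary.PropositionalEquality as ≡ using (_≡_; cong; cong₂; subst)

private
  variable
    ℓ₁ ℓ₂ ℓ₃ : Level
    A : Set ℓ₁
    B : Set ℓ₂
    C : Set ℓ₃

length-take-≤ : ∀ m (xs : List A) → m ≤ length xs → length (take m xs) ≡ m
length-take-≤ m xs m≤ = ≡.trans (length-take m xs) (ℕ.m≤n⇒m⊓n≡m m≤)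

length-drop-+ : ∀ m n (xs : List A) → length xs ≡ m +ℕ n → length (drop m xs) ≡ n
length-drop-+ m n xs eq = ≡.trans (length-drop m xs) (≡.trans (cong (_∸ m) eq) (ℕ.m+n∸m≡n m n))

≤-length-+ : ∀ m n (xs : List A) → length xs ≡ m +ℕ n → m ≤ length xs
≤-length-+ m n xs eq = subst (m ≤_) (≡.sym eq) (ℕ.m≤m+n m n)

take-take-suc : ∀ m (xs : List A) → take m (take (suc m) xs) ≡ take m xs
take-take-suc m xs = ≡.trans (take-take m (suc m) xs) (cong (λ k → take k xs) (ℕ.m≤n⇒m⊓n≡m (ℕ.n≤1+n m)))

toList-zipWith : ∀ {n} (J : A → B → C) (u : Vec A n) (v : Vec B n) →
                 Vec.toList (Vec.zipWith J u v) ≡ List.zipWith J (Vec.toList u) (Vec.toList v)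
toList-zipWith J Vec.[]      Vec.[]      = ≡.refl
toList-zipWith J (x Vec.∷ u) (y Vec.∷ v) = cong (J x y ∷_) (toList-zipWith J u v)

zipWith-applyUpTo-applyDownFrom : (J : A → B → C) (h : ℕ → A) (k : ℕ → B) (m : ℕ) →
  List.zipWith J (applyUpTo h (suc m)) (applyDownFrom k (suc m)) ≡ applyUpTo (λ i → J (h i) (k (m ∸ i))) (suc m)
zipWith-applyUpTo-applyDownFrom J h k zero    = ≡.refl
zipWith-applyUpTo-applyDownFrom J h k (suc m) =
  cong (J (h 0) (k (suc m)) ∷_) (zipWith-applyUpTo-applyDownFrom J (h ∘ suc) k m)

joins : List Tree → List Tree → List Tree
joins σs ρs = concatMap (λ σ → map (σ ∨_) ρs) σs

toList-Ytable : ∀ n → Vec.toList (Ytable n) ≡ applyUpTo Y (suc n)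
toList-Ytable zero    = ≡.refl
toList-Ytable (suc n) = begin
  Vec.toList (Ytable (suc n))       ≡⟨ toList-∷ʳ _ (Ytable n) ⟩
  Vec.toList (Ytable n) ∷ʳ _        ≡⟨ cong₂ _∷ʳ_ (toList-Ytable n) (≡.sym (last-∷ʳ _ (Ytable n))) ⟩
  applyUpTo Y (suc n) ∷ʳ Y (suc n)  ≡⟨ applyUpTo-∷ʳ Y (suc n) ⟩
  applyUpTo Y (suc (suc n))         ∎
  where open ≡.≡-Reasoning

Y-suc : ∀ n → Y (suc n) ≡ concat (applyUpTo (λ i → joins (Y i) (Y (n ∸ i))) (suc n))
Y-suc n = begin
  Y (suc n)
    ≡⟨ last-∷ʳ _ t ⟩
  concat (Vec.toList (Vec.zipWith _ t (Vec.reverse t)))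
    ≡⟨ cong concat (toList-zipWith _ t (Vec.reverse t)) ⟩
  concat (List.zipWith _ (Vec.toList t) (Vec.toList (Vec.reverse t)))
    ≡⟨ cong concat (cong₂ (List.zipWith joins) (toList-Ytable n) toList-reverse-Ytable) ⟩
  concat (List.zipWith joins (applyUpTo Y (suc n)) (applyDownFrom Y (suc n)))
    ≡⟨ cong concat (zipWith-applyUpTo-applyDownFrom joins Y Y n) ⟩
  concat (applyUpTo (λ i → joins (Y i) (Y (n ∸ i))) (suc n)) ∎
  where
  open ≡.≡-Reasoning
  t = Ytable n
  toList-reverse-Ytable : Vec.toList (Vec.reverse t) ≡ applyDownFrom Y (suc n)
  toList-reverse-Ytable =
    ≡.trans (toList-reverse t) (≡.trans (cong List.reverse (toList-Ytable n)) (reverse-applyUpTo Y (suc n)))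

OfSize : ℕ → Tree → Set
OfSize n τ = size τ ≡ n

joins-OfSize : ∀ {m n σs ρs} → All (OfSize m) σs → All (OfSize n) ρs →
               All (OfSize (suc (m +ℕ n))) (joins σs ρs)
joins-OfSize σs ρs =
  concat⁺ (map⁺ (All.map (λ σ≡ → map⁺ (All.map (λ ρ≡ → cong suc (cong₂ _+ℕ_ σ≡ ρ≡)) ρs)) σs))

size-Y : ∀ n → All (OfSize n) (Y n)
size-Y = <-rec _ size-Y-step
  where
  size-Y-step : ∀ n → (∀ {m} → m < n → All (OfSize m) (Y m)) → All (OfSize n) (Y n)
  size-Y-step zero    _  = ≡.refl ∷ []
  size-Y-step (suc n) ih = subst (All (OfSize (suc n))) (≡.sym (Y-suc n)) (concat⁺ (applyUpTo⁺₁ _ (suc n) joins-suc))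
    where
    joins-suc : ∀ {i} → i < suc n → All (OfSize (suc n)) (joins (Y i) (Y (n ∸ i)))
    joins-suc {i} (s≤s i≤n) = subst (λ k → All (OfSize (suc k)) (joins (Y i) (Y (n ∸ i)))) (ℕ.m+[n∸m]≡n i≤n)
                                    (joins-OfSize (ih (s≤s i≤n)) (ih (s≤s (ℕ.m∸n≤m n i))))

size-R : ∀ τ → size (R τ) ≡ size τ +ℕ size τ
size-R leaf    = ≡.refl
size-R (σ ∨ ρ) = begin
  suc (suc (size (R σ)) +ℕ size (R ρ))
    ≡⟨ cong₂ (λ s t → suc (suc s +ℕ t)) (size-R σ) (size-R ρ) ⟩
  suc (suc ((size σ +ℕ size σ) +ℕ (size ρ +ℕ size ρ)))
    ≡⟨ cong (suc ∘ suc) (interchange ℕ.+-commutativeSemigroup (size σ) _ (size ρ) _) ⟩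
  suc (suc ((size σ +ℕ size ρ) +ℕ (size σ +ℕ size ρ)))
    ≡⟨ cong suc (≡.sym (ℕ.+-suc _ _)) ⟩
  size (σ ∨ ρ) +ℕ size (σ ∨ ρ) ∎
  where open ≡.≡-Reasoning

module ListSum {s ℓs} (S : Semiring s ℓs) where
  open Semiring S
  open import Relation.Binary.Reasoning.Setoid setoid

  ∑ : List A → (A → Carrier) → Carrier
  ∑ xs F = foldr _+_ 0# (map F xs)

  syntax ∑ xs (λ x → e) = ∑[ x ∈ xs ] e

  ∑-cong-All : ∀ {F G : A → Carrier} {xs} → All (λ x → F x ≈ G x) xs → ∑ xs F ≈ ∑ xs G
  ∑-cong-All []       = refl
  ∑-cong-All (e ∷ es) = +-cong e (∑-cong-All es)

  ∑-cong : ∀ {F G : A → Carrier} xs → (∀ x → F x ≈ G x) → ∑ xs F ≈ ∑ xs G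
  ∑-cong xs e = ∑-cong-All (All.universal e xs)

  ∑-++ : ∀ xs ys (F : A → Carrier) → ∑ (xs ++ ys) F ≈ ∑ xs F + ∑ ys F
  ∑-++ []       ys F = sym (+-identityˡ _)
  ∑-++ (x ∷ xs) ys F = trans (+-congˡ (∑-++ xs ys F)) (sym (+-assoc _ _ _))

  ∑-concat : ∀ xss (F : A → Carrier) → ∑ (concat xss) F ≈ ∑[ xs ∈ xss ] ∑ xs F
  ∑-concat []         F = refl
  ∑-concat (xs ∷ xss) F = trans (∑-++ xs (concat xss) F) (+-congˡ (∑-concat xss F))

  ∑-map : ∀ (k : A → B) xs (F : B → Carrier) → ∑ (map k xs) F ≡ ∑ xs (F ∘ k)
  ∑-map k []       F = ≡.refl
  ∑-map k (x ∷ xs) F = cong (F (k x) +_) (∑-map k xs F)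

  ∑-applyUpTo : ∀ (h : ℕ → A) n (F : A → Carrier) → ∑ (applyUpTo h n) F ≡ ∑ (upTo n) (F ∘ h)
  ∑-applyUpTo h n F = cong (foldr _+_ 0#) (≡.trans (map-applyUpTo h F n) (≡.sym (map-upTo (F ∘ h) n)))

  ∑-zero : ∀ (xs : List A) → ∑[ x ∈ xs ] 0# ≈ 0#
  ∑-zero []       = refl
  ∑-zero (x ∷ xs) = trans (+-identityˡ _) (∑-zero xs)

  ∑-distrib-+ : ∀ xs (F G : A → Carrier) → ∑[ x ∈ xs ] (F x + G x) ≈ ∑ xs F + ∑ xs G
  ∑-distrib-+ []       F G = sym (+-identityˡ _)
  ∑-distrib-+ (x ∷ xs) F G = trans (+-congˡ (∑-distrib-+ xs F G)) (interchange +-commutativeSemigroup _ _ _ _)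

  ∑-comm : ∀ xs ys (F : A → B → Carrier) →
           ∑[ x ∈ xs ] ∑[ y ∈ ys ] F x y ≈ ∑[ y ∈ ys ] ∑[ x ∈ xs ] F x y
  ∑-comm []       ys F = sym (∑-zero ys)
  ∑-comm (x ∷ xs) ys F =
    trans (+-congˡ (∑-comm xs ys F)) (sym (∑-distrib-+ ys (F x) (λ y → ∑[ x ∈ xs ] F x y)))

  ∑-distribʳ : ∀ xs (F : A → Carrier) z → ∑ xs F * z ≈ ∑[ x ∈ xs ] (F x * z)
  ∑-distribʳ []       F z = zeroˡ z
  ∑-distribʳ (x ∷ xs) F z = trans (distribʳ z _ _) (+-congˡ (∑-distribʳ xs F z))

  ∑-joins : ∀ σs ρs (φ : Tree → Carrier) → ∑ (joins σs ρs) φ ≈ ∑[ σ ∈ σs ] ∑[ ρ ∈ ρs ] φ (σ ∨ ρ)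
  ∑-joins σs ρs φ = begin
    ∑ (concat (map σ∨ρs σs)) φ        ≈⟨ ∑-concat (map σ∨ρs σs) φ ⟩
    ∑[ ts ∈ map σ∨ρs σs ] ∑ ts φ      ≡⟨ ∑-map σ∨ρs σs (λ ts → ∑ ts φ) ⟩
    ∑[ σ ∈ σs ] ∑ (σ∨ρs σ) φ          ≡⟨ cong (foldr _+_ 0#) (map-cong (λ σ → ∑-map (σ ∨_) ρs φ) σs) ⟩
    ∑[ σ ∈ σs ] ∑[ ρ ∈ ρs ] φ (σ ∨ ρ) ∎
    where
    σ∨ρs : Tree → List Tree
    σ∨ρs σ = map (σ ∨_) ρs

  ∑-Y-suc : ∀ n (φ : Tree → Carrier) →
            ∑ (Y (suc n)) φ ≈ ∑[ i ∈ upTo (suc n) ] ∑[ σ ∈ Y i ] ∑[ ρ ∈ Y (n ∸ i) ] φ (σ ∨ ρ)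
  ∑-Y-suc n φ = begin
    ∑ (Y (suc n)) φ                                ≡⟨ cong (λ ts → ∑ ts φ) (Y-suc n) ⟩
    ∑ (concat (applyUpTo joins-Y (suc n))) φ       ≈⟨ ∑-concat (applyUpTo joins-Y (suc n)) φ ⟩
    ∑[ ts ∈ applyUpTo joins-Y (suc n) ] ∑ ts φ     ≡⟨ ∑-applyUpTo joins-Y (suc n) (λ ts → ∑ ts φ) ⟩
    ∑[ i ∈ upTo (suc n) ] ∑ (joins-Y i) φ          ≈⟨ ∑-cong (upTo (suc n)) (λ i → ∑-joins (Y i) (Y (n ∸ i)) φ) ⟩
    ∑[ i ∈ upTo (suc n) ] ∑[ σ ∈ Y i ] ∑[ ρ ∈ Y (n ∸ i) ] φ (σ ∨ ρ) ∎
    where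
    joins-Y : ℕ → List Tree
    joins-Y i = joins (Y i) (Y (n ∸ i))

  ∑-Y-size : ∀ n (F : ℕ → Tree → Carrier) → ∑[ σ ∈ Y n ] F (size σ) σ ≈ ∑[ σ ∈ Y n ] F n σ
  ∑-Y-size n F = ∑-cong-All (All.map (λ {σ} σ≡ → reflexive (cong (λ k → F k σ) σ≡)) (size-Y n))

module MultSeries {k ℓk b ℓb} {K : Field k ℓk} (𝔸 : UnitalAlgebra K b ℓb) where
  open UnitalAlgebra 𝔸
  open Series 𝔸
  open ListSum semiring
  open import Relation.Binary.Reasoning.Setoid setoid

  module _ (h : Mult) where
    open Mult h

    slot-cong : ∀ us vs {x y} → x ≈ y → fun (us ++ x ∷ vs) ≈ fun (us ++ y ∷ vs)
    slot-cong us vs x≈y = fun-cong (Pointwise.++⁺ (Pointwise.refl refl) (x≈y ∷ Pointwise.refl refl))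

    slot-0 : ∀ us vs → fun (us ++ 0# ∷ vs) ≈ 0#
    slot-0 us vs = begin
      fun (us ++ 0# ∷ vs)            ≈⟨ slot-cong us vs (sym (0·x≈0 0#)) ⟩
      fun (us ++ (K.0# · 0#) ∷ vs)   ≈⟨ homogeneous us vs K.0# 0# ⟩
      K.0# · fun (us ++ 0# ∷ vs)     ≈⟨ 0·x≈0 _ ⟩
      0#                             ∎
      where
      0·x≈0 : ∀ x → K.0# · x ≈ 0#
      0·x≈0 = IsLeftModule.*ₗ-zeroˡ isLeftModule

    slot-∑ : ∀ us vs (xs : List A) (G : A → Carrier) →
             fun (us ++ ∑ xs G ∷ vs) ≈ ∑[ x ∈ xs ] fun (us ++ G x ∷ vs)
    slot-∑ us vs []       G = slot-0 us vs
    slot-∑ us vs (x ∷ xs) G = trans (additive us vs (G x) (∑ xs G)) (+-congˡ (slot-∑ us vs xs G))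

  ∑-blocks-∷ : ∀ H (φ : List Carrier → Carrier) x rest →
               ∑ (blocks H (x ∷ rest)) φ
               ≈ ∑[ i ∈ upTo (suc (length rest)) ] ∑[ cs ∈ blocks H (drop i rest) ] φ (H (x ∷ take i rest) ∷ cs)
  ∑-blocks-∷ H φ x = ∑-go (x ∷ [])
    where
    by-first-block : List Carrier → List Carrier → ℕ → Carrier
    by-first-block acc rest i = ∑[ cs ∈ blocks H (drop i rest) ] φ (H (acc ++ take i rest) ∷ cs)

    ∑-go : ∀ acc rest → ∑ (go H acc rest) φ ≈ ∑ (upTo (suc (length rest))) (by-first-block acc rest)
    ∑-go acc []       =
      +-congʳ (trans (reflexive (cong (λ ws → φ (H ws ∷ [])) (≡.sym (++-identityʳ acc)))) (sym (+-identityʳ _)))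
    ∑-go acc (y ∷ ys) = begin
      ∑ (go H (acc ∷ʳ y) ys ++ map (H acc ∷_) (go H (y ∷ []) ys)) φ
        ≈⟨ ∑-++ (go H (acc ∷ʳ y) ys) _ φ ⟩
      ∑ (go H (acc ∷ʳ y) ys) φ + ∑ (map (H acc ∷_) (go H (y ∷ []) ys)) φ
        ≈⟨ +-comm _ _ ⟩
      ∑ (map (H acc ∷_) (go H (y ∷ []) ys)) φ + ∑ (go H (acc ∷ʳ y) ys) φ
        ≈⟨ +-cong (reflexive first-block-y) (∑-go (acc ∷ʳ y) ys) ⟩
      by-first-block acc (y ∷ ys) 0 + ∑ (upTo (suc (length ys))) (by-first-block (acc ∷ʳ y) ys)
        ≈⟨ +-congˡ (∑-cong (upTo (suc (length ys))) (reflexive ∘ shift)) ⟩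
      by-first-block acc (y ∷ ys) 0 + ∑ (upTo (suc (length ys))) (by-first-block acc (y ∷ ys) ∘ suc)
        ≈⟨ +-congˡ (reflexive (≡.sym (∑-applyUpTo suc (suc (length ys)) _))) ⟩
      ∑ (upTo (suc (length (y ∷ ys)))) (by-first-block acc (y ∷ ys)) ∎
      where
      shift : ∀ i → by-first-block (acc ∷ʳ y) ys i ≡ by-first-block acc (y ∷ ys) (suc i)
      shift i = cong (λ ws → ∑[ cs ∈ blocks H (drop i ys) ] φ (H ws ∷ cs)) (++-assoc acc (y ∷ []) (take i ys))

      first-block-y : ∑ (map (H acc ∷_) (go H (y ∷ []) ys)) φ ≡ by-first-block acc (y ∷ ys) 0
      first-block-y = ≡.trans (∑-map (H acc ∷_) (go H (y ∷ []) ys) φ)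
                              (cong (λ ws → ∑[ cs ∈ go H (y ∷ []) ys ] φ (H ws ∷ cs)) (≡.sym (++-identityʳ acc)))

  spineWith : (Tree → List Carrier → Carrier) → Tree → List Carrier → List Carrier
  spineWith Φ leaf    xs = []
  spineWith Φ (σ ∨ ρ) xs = Φ σ (take (suc (size σ)) xs) ∷ spineWith Φ ρ (drop (suc (size σ)) xs)

  module _ (h : Mult) (H : Seq) (Φ : Tree → List Carrier → Carrier)
           (∑Φ≈H : ∀ x rest → ∑[ σ ∈ Y (length rest) ] Φ σ (x ∷ rest) ≈ H (x ∷ rest)) where
    open Mult h using (fun)

    -- Peeling off the first block moves its value into the prefix us, so the induction must carry it.
    ∑-spineWith≈∘ˢ-prefix : ∀ n us xs → length xs ≡ n →
      ∑[ τ ∈ Y n ] fun (us ++ spineWith Φ τ xs) ≈ ∑[ cs ∈ blocks H xs ] fun (us ++ cs)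
    ∑-spineWith≈∘ˢ-prefix = <-rec _ step
      where
      Expands : ℕ → Set _
      Expands n = ∀ us xs → length xs ≡ n →
                  ∑[ τ ∈ Y n ] fun (us ++ spineWith Φ τ xs) ≈ ∑[ cs ∈ blocks H xs ] fun (us ++ cs)

      step : ∀ n → (∀ {m} → m < n → Expands m) → Expands n
      step _ ih us []         ≡.refl = refl
      step _ ih us (x ∷ rest) ≡.refl = begin
        ∑[ τ ∈ Y (suc n) ] fun (us ++ spineWith Φ τ (x ∷ rest))
          ≈⟨ ∑-Y-suc n _ ⟩
        ∑[ i ∈ upTo (suc n) ] ∑[ σ ∈ Y i ] ∑[ ρ ∈ Y (n ∸ i) ] term (size σ) σ ρ
          ≈⟨ ∑-cong-All (All.map (λ { (s≤s i≤n) → first-block _ i≤n }) (all-upTo (suc n))) ⟩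
        ∑[ i ∈ upTo (suc n) ] ∑[ cs ∈ blocks H (drop i rest) ] fun (us ++ H (x ∷ take i rest) ∷ cs)
          ≈⟨ sym (∑-blocks-∷ H (λ cs → fun (us ++ cs)) x rest) ⟩
        ∑[ cs ∈ blocks H (x ∷ rest) ] fun (us ++ cs) ∎
        where
        n = length rest

        term : ℕ → Tree → Tree → Carrier
        term i σ ρ = fun (us ++ Φ σ (x ∷ take i rest) ∷ spineWith Φ ρ (drop i rest))

        first-block : ∀ i → i ≤ n →
          ∑[ σ ∈ Y i ] ∑[ ρ ∈ Y (n ∸ i) ] term (size σ) σ ρ
          ≈ ∑[ cs ∈ blocks H (drop i rest) ] fun (us ++ H (x ∷ take i rest) ∷ cs)
        first-block i i≤n = begin
          ∑[ σ ∈ Y i ] ∑[ ρ ∈ Y (n ∸ i) ] term (size σ) σ ρ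
            ≈⟨ ∑-Y-size i (λ j σ → ∑[ ρ ∈ Y (n ∸ i) ] term j σ ρ) ⟩
          ∑[ σ ∈ Y i ] ∑[ ρ ∈ Y (n ∸ i) ] term i σ ρ
            ≈⟨ ∑-comm (Y i) (Y (n ∸ i)) (term i) ⟩
          ∑[ ρ ∈ Y (n ∸ i) ] ∑[ σ ∈ Y i ] term i σ ρ
            ≈⟨ ∑-cong (Y (n ∸ i)) (λ ρ → sym (slot-∑ h us _ (Y i) _)) ⟩
          ∑[ ρ ∈ Y (n ∸ i) ] fun (us ++ ∑[ σ ∈ Y i ] Φ σ (x ∷ take i rest) ∷ spineWith Φ ρ (drop i rest))
            ≈⟨ ∑-cong (Y (n ∸ i)) (λ ρ → slot-cong h us _ ∑Φ≈H-take) ⟩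
          ∑[ ρ ∈ Y (n ∸ i) ] fun (us ++ H (x ∷ take i rest) ∷ spineWith Φ ρ (drop i rest))
            ≈⟨ ∑-cong (Y (n ∸ i)) (λ ρ → reflexive (cong fun (≡.sym (++-assoc us _ _)))) ⟩
          ∑[ ρ ∈ Y (n ∸ i) ] fun ((us ∷ʳ H (x ∷ take i rest)) ++ spineWith Φ ρ (drop i rest))
            ≈⟨ ih (s≤s (ℕ.m∸n≤m n i)) (us ∷ʳ H (x ∷ take i rest)) (drop i rest) (length-drop i rest) ⟩
          ∑[ cs ∈ blocks H (drop i rest) ] fun ((us ∷ʳ H (x ∷ take i rest)) ++ cs)
            ≈⟨ ∑-cong (blocks H (drop i rest)) (λ cs → reflexive (cong fun (++-assoc us _ cs))) ⟩
          ∑[ cs ∈ blocks H (drop i rest) ] fun (us ++ H (x ∷ take i rest) ∷ cs) ∎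
          where
          ∑Φ≈H-take : ∑[ σ ∈ Y i ] Φ σ (x ∷ take i rest) ≈ H (x ∷ take i rest)
          ∑Φ≈H-take = trans (reflexive (cong (λ j → ∑[ σ ∈ Y j ] Φ σ (x ∷ take i rest))
                                              (≡.sym (length-take-≤ i rest i≤n))))
                            (∑Φ≈H x (take i rest))

    ∑-spineWith≈∘ˢ : ∀ xs → ∑[ τ ∈ Y (length xs) ] fun (spineWith Φ τ xs) ≈ (fun ∘ˢ H) xs
    ∑-spineWith≈∘ˢ xs = ∑-spineWith≈∘ˢ-prefix (length xs) [] xs ≡.refl

  take-1∷x1 : ∀ k ys → k ≤ length ys → take (k +ℕ k) (1# ∷ x1 ys) ≡ 1x (take k ys)
  take-1∷x1 zero    ys       _        = ≡.refl
  take-1∷x1 (suc k) (y ∷ ys) (s≤s k≤) rewrite ℕ.+-suc k k = cong (λ l → 1# ∷ y ∷ l) (take-1∷x1 k ys k≤)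

  hd-drop-1∷x1 : ∀ k ys → k ≤ length ys → hd (drop (k +ℕ k) (1# ∷ x1 ys)) ≡ 1#
  hd-drop-1∷x1 zero    ys       _        = ≡.refl
  hd-drop-1∷x1 (suc k) (y ∷ ys) (s≤s k≤) rewrite ℕ.+-suc k k = hd-drop-1∷x1 k ys k≤

  drop-x1 : ∀ k ys → drop (k +ℕ k) (x1 ys) ≡ x1 (drop k ys)
  drop-x1 zero    ys       = ≡.refl
  drop-x1 (suc k) []       = ≡.refl
  drop-x1 (suc k) (y ∷ ys) rewrite ℕ.+-suc k k = drop-x1 k ys

  take-∷1x : ∀ k x ys → k ≤ length ys → take (k +ℕ k) (x ∷ 1x ys) ≡ x1 (take k (x ∷ ys))
  take-∷1x zero    x ys       _        = ≡.refl
  take-∷1x (suc k) x (y ∷ ys) (s≤s k≤) rewrite ℕ.+-suc k k =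
    cong (λ l → x ∷ 1# ∷ l) (take-∷1x k y ys k≤)

  hd-drop-∷1x : ∀ k x ys → hd (drop (k +ℕ k) (x ∷ 1x ys)) ≡ hd (drop k (x ∷ ys))
  hd-drop-∷1x zero    x ys       = ≡.refl
  hd-drop-∷1x (suc k) x []       rewrite ℕ.+-suc k k = cong hd (≡.sym (drop-[] k))
  hd-drop-∷1x (suc k) x (y ∷ ys) rewrite ℕ.+-suc k k = hd-drop-∷1x k y ys

  drop-1x : ∀ k ys → drop (k +ℕ k) (1x ys) ≡ 1x (drop k ys)
  drop-1x zero    ys       = ≡.refl
  drop-1x (suc k) []       = ≡.refl
  drop-1x (suc k) (y ∷ ys) rewrite ℕ.+-suc k k = drop-1x k ys

  hd-drop-take-suc : ∀ m xs → hd (drop m (take (suc m) xs)) ≡ hd (drop m xs)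
  hd-drop-take-suc zero    []       = ≡.refl
  hd-drop-take-suc zero    (x ∷ xs) = ≡.refl
  hd-drop-take-suc (suc m) []       = ≡.refl
  hd-drop-take-suc (suc m) (x ∷ xs) = hd-drop-take-suc m xs

  take-∷ʳ-hd-drop : ∀ m xs → length xs ≡ suc m → take m xs ∷ʳ hd (drop m xs) ≡ xs
  take-∷ʳ-hd-drop zero    (x ∷ [])     _  = ≡.refl
  take-∷ʳ-hd-drop (suc m) (x ∷ y ∷ xs) eq = cong (x ∷_) (take-∷ʳ-hd-drop m (y ∷ xs) (ℕ.suc-injective eq))

  ⊙-I-∷ʳ : ∀ (k : Seq) ys z → (k ⊙ I) (ys ∷ʳ z) ≈ k ys * z
  ⊙-I-∷ʳ k []       z = trans (+-congˡ (trans (+-identityʳ _) (zeroʳ _))) (+-identityʳ _)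
  ⊙-I-∷ʳ k (y ∷ ys) z = begin
    (k ⊙ I) (y ∷ ys ∷ʳ z)
      ≡⟨ cong (k [] * I (y ∷ ys ∷ʳ z) +_) (∑-map _ (splits (ys ∷ʳ z)) _) ⟩
    k [] * I (y ∷ ys ∷ʳ z) + ((k ∘ (y ∷_)) ⊙ I) (ys ∷ʳ z)
      ≈⟨ +-congʳ (trans (*-congˡ (reflexive (I-vanishes ys))) (zeroʳ _)) ⟩
    0# + ((k ∘ (y ∷_)) ⊙ I) (ys ∷ʳ z)
      ≈⟨ +-identityˡ _ ⟩
    ((k ∘ (y ∷_)) ⊙ I) (ys ∷ʳ z)
      ≈⟨ ⊙-I-∷ʳ (k ∘ (y ∷_)) ys z ⟩
    k (y ∷ ys) * z ∎
    where
    I-vanishes : ∀ ws → I (y ∷ ws ∷ʳ z) ≡ 0#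
    I-vanishes []      = ≡.refl
    I-vanishes (_ ∷ _) = ≡.refl

  module _ (f g : Mult) where

    ⊞₁-summand : Tree → List Carrier → Carrier
    ⊞₁-summand σ []       = 0#  -- junk: blocks are never empty
    ⊞₁-summand σ (x ∷ xs) = cup ⟦ g ⟧ ⟦ f ⟧ (leaf ∨ R σ) (x ∷ 1x xs)

    spine-R-x1 : ∀ τ xs → length xs ≡ size τ →
                 Pointwise _≈_ (spine ⟦ f ⟧ ⟦ g ⟧ (R τ) (x1 xs)) (spineWith ⊞₁-summand τ xs)
    spine-R-x1 leaf    []         _  = []
    spine-R-x1 (σ ∨ ρ) (x ∷ rest) eq
      rewrite size-R σ
            | take-1∷x1 (size σ) rest (≤-length-+ (size σ) (size ρ) rest (ℕ.suc-injective eq))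
            | hd-drop-1∷x1 (size σ) rest (≤-length-+ (size σ) (size ρ) rest (ℕ.suc-injective eq))
            | drop-x1 (size σ) rest
      = *-identityʳ _
      ∷ spine-R-x1 ρ (drop (size σ) rest) (length-drop-+ (size σ) (size ρ) rest (ℕ.suc-injective eq))

    ⊞≋∘ˢ⊞₁ : (⟦ f ⟧ ⊞ ⟦ g ⟧) ≋ (⟦ g ⟧ ∘ˢ (⟦ f ⟧ ⊞₁ ⟦ g ⟧))
    ⊞≋∘ˢ⊞₁ []         = sym (+-identityʳ _)
    ⊞≋∘ˢ⊞₁ xs@(_ ∷ _) = trans (∑-cong-All (All.map (λ {τ} → summand≈ τ) (size-Y (length xs))))
                              (∑-spineWith≈∘ˢ g (⟦ f ⟧ ⊞₁ ⟦ g ⟧) ⊞₁-summand (λ _ _ → refl) xs)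
      where
      summand≈ : ∀ τ → OfSize (length xs) τ →
                 cup ⟦ f ⟧ ⟦ g ⟧ (R τ) (x1 xs) ≈ ⟦ g ⟧ (spineWith ⊞₁-summand τ xs)
      summand≈ (σ ∨ ρ) eq = Mult.fun-cong g (spine-R-x1 (σ ∨ ρ) xs (≡.sym eq))

    ⊞₂-summand : Tree → List Carrier → Carrier
    ⊞₂-summand σ ws = cup ⟦ f ⟧ ⟦ g ⟧ (leaf ∨ R σ) (1# ∷ x1 ws)

    ⊞₂⊙I-summand : Tree → List Carrier → Carrier
    ⊞₂⊙I-summand σ ys = ⊞₂-summand σ (take (size σ) ys) * hd (drop (size σ) ys)

    ⊞₂-as-∑ : ∀ ws → ∑[ σ ∈ Y (length ws) ] ⊞₂-summand σ ws ≈ (⟦ f ⟧ ⊞₂ ⟦ g ⟧) ws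
    ⊞₂-as-∑ []      = trans (+-identityʳ _) (Mult.fun-cong g (*-identityˡ 1# ∷ []))
    ⊞₂-as-∑ (_ ∷ _) = refl

    ∑-⊞₂⊙I-summand : ∀ x rest →
                     ∑[ σ ∈ Y (length rest) ] ⊞₂⊙I-summand σ (x ∷ rest) ≈ ((⟦ f ⟧ ⊞₂ ⟦ g ⟧) ⊙ I) (x ∷ rest)
    ∑-⊞₂⊙I-summand x rest = begin
      ∑[ σ ∈ Y n ] ⊞₂⊙I-summand σ (x ∷ rest)
        ≈⟨ ∑-Y-size n (λ j σ → ⊞₂-summand σ (take j (x ∷ rest)) * hd (drop j (x ∷ rest))) ⟩
      ∑[ σ ∈ Y n ] (⊞₂-summand σ ws * z)
        ≈⟨ sym (∑-distribʳ (Y n) (λ σ → ⊞₂-summand σ ws) z) ⟩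
      ∑[ σ ∈ Y n ] ⊞₂-summand σ ws * z
        ≈⟨ *-congʳ (trans (reflexive (cong (λ j → ∑[ σ ∈ Y j ] ⊞₂-summand σ ws)
                                            (≡.sym (length-take-≤ n (x ∷ rest) (ℕ.n≤1+n n)))))
                          (⊞₂-as-∑ ws)) ⟩
      (⟦ f ⟧ ⊞₂ ⟦ g ⟧) ws * z
        ≈⟨ sym (⊙-I-∷ʳ (⟦ f ⟧ ⊞₂ ⟦ g ⟧) ws z) ⟩
      ((⟦ f ⟧ ⊞₂ ⟦ g ⟧) ⊙ I) (ws ∷ʳ z)
        ≡⟨ cong ((⟦ f ⟧ ⊞₂ ⟦ g ⟧) ⊙ I) (take-∷ʳ-hd-drop n (x ∷ rest) ≡.refl) ⟩
      ((⟦ f ⟧ ⊞₂ ⟦ g ⟧) ⊙ I) (x ∷ rest) ∎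
      where
      n  = length rest
      ws = take n (x ∷ rest)
      z  = hd (drop n (x ∷ rest))

    spine-R-1x : ∀ τ xs → length xs ≡ size τ →
                 spine ⟦ g ⟧ ⟦ f ⟧ (R τ) (1x xs) ≡ spineWith ⊞₂⊙I-summand τ xs
    spine-R-1x leaf    []         _  = ≡.refl
    spine-R-1x (σ ∨ ρ) (x ∷ rest) eq
      rewrite size-R σ
            | take-∷1x (size σ) x rest (≤-length-+ (size σ) (size ρ) rest (ℕ.suc-injective eq))
            | hd-drop-∷1x (size σ) x rest
            | drop-1x (size σ) rest
      = cong₂ _∷_ (cong₂ (λ ws z → ⊞₂-summand σ ws * z)
                         (≡.sym (take-take-suc (size σ) (x ∷ rest)))
                         (≡.sym (hd-drop-take-suc (size σ) (x ∷ rest))))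
                  (spine-R-1x ρ (drop (size σ) rest) (length-drop-+ (size σ) (size ρ) rest (ℕ.suc-injective eq)))

    ⊞̲≋∘ˢ⊞₂⊙I : (⟦ g ⟧ ⊞̲ ⟦ f ⟧) ≋ (⟦ f ⟧ ∘ˢ ((⟦ f ⟧ ⊞₂ ⟦ g ⟧) ⊙ I))
    ⊞̲≋∘ˢ⊞₂⊙I []         = sym (+-identityʳ _)
    ⊞̲≋∘ˢ⊞₂⊙I xs@(_ ∷ _) = trans (∑-cong-All (All.map (λ {τ} → summand≈ τ) (size-Y (length xs))))
                                (∑-spineWith≈∘ˢ f ((⟦ f ⟧ ⊞₂ ⟦ g ⟧) ⊙ I) ⊞₂⊙I-summand ∑-⊞₂⊙I-summand xs)
      where
      summand≈ : ∀ τ → OfSize (length xs) τ →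
                 cup ⟦ g ⟧ ⟦ f ⟧ (R τ) (1x xs) ≈ ⟦ f ⟧ (spineWith ⊞₂⊙I-summand τ xs)
      summand≈ (σ ∨ ρ) eq = reflexive (cong ⟦ f ⟧ (spine-R-1x (σ ∨ ρ) xs (≡.sym eq)))

lemma3p21 : ∀ {c ℓ b ℓb} (F : Field c ℓ) → CharZero F →
            (A : UnitalAlgebra F b ℓb) → (f g : Series.Mult A) →
            let open Series A in
            ((⟦ f ⟧ ⊞ ⟦ g ⟧) ≋ (⟦ g ⟧ ∘ˢ (⟦ f ⟧ ⊞₁ ⟦ g ⟧)))
            × ((⟦ g ⟧ ⊞̲ ⟦ f ⟧) ≋ (⟦ f ⟧ ∘ˢ ((⟦ f ⟧ ⊞₂ ⟦ g ⟧) ⊙ I)))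
lemma3p21 F _ A f g = MultSeries.⊞≋∘ˢ⊞₁ A f g , MultSeries.⊞̲≋∘ˢ⊞₂⊙I A f g
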